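{- For any integers $q\ge p\ge 3$, if $\bar{d}(K(2,p,q))=2$, then $q\le \binom{p}{\lfloor p/2\rfloor}$.
   Context: $K(2,p,q)$ is the complete tripartite graph with partite sets of sizes $2$, $p$, $q$. For a connected bridgeless graph $G$, $\mathscr{D}(G)$ is the family of strong orientations of $G$ (orientations in which every two vertices are mutually reachable), and the orientation number is $\bar d(G)=\min\{d(D): D\in\mathscr{D}(G)\}$, where $d(D)$ is the diameter of the digraph $D$ (maximum over ordered pairs of vertices of the length of a shortest directed path). -}

module Defs where

open import Data.Nat using (ℕ; zero; suc; _+_; _≤_; _<_)
open import Data.Fin using (Fin; toℕ)
open import Data.Bool using (Bool; true; false)
open import Data.Product using (Σ; ∃; _×_; _,_)
open import Data.Sum using (_⊎_)
open import Relation.Binary.PropositionalEquality using (_≡_; _≢_)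
open import Relation.Nullary using (¬_)

record Graph : Set₁ where
  field
    order : ℕ
    Adj   : Fin order → Fin order → Set
    sym   : ∀ {u v} → Adj u v → Adj v u
    irrefl : ∀ {u} → ¬ Adj u u
open Graph public

-- Complete tripartite graph K(a,b,c): vertex v belongs to part 0 if toℕ v < a,
-- to part 1 if a ≤ toℕ v < a + b, and to part 2 otherwise.
part : (a b : ℕ) → ℕ → ℕ
part a b i with i Data.Nat.<ᵇ a
... | true = 0
... | false with i Data.Nat.<ᵇ (a + b)
...   | true = 1
...   | false = 2

open import Relation.Binary.PropositionalEquality using (sym; refl)

K3 : ℕ → ℕ → ℕ → Graph
K3 a b c = record
  { order = a + b + c
  ; Adj = λ u v → part a b (toℕ u) ≢ part a b (toℕ v)
  ; sym = λ ne eq → ne (Relation.Binary.PropositionalEquality.sym eq)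
  ; irrefl = λ ne → ne refl
  }

record Orientation (G : Graph) : Set₁ where
  field
    Arc      : Fin (order G) → Fin (order G) → Set
    arc⇒edge : ∀ {u v} → Arc u v → Adj G u v
    edge⇒arc : ∀ {u v} → Adj G u v → Arc u v ⊎ Arc v u
    antisym  : ∀ {u v} → Arc u v → ¬ Arc v u
open Orientation public

data Walk {G : Graph} (D : Orientation G) : Fin (order G) → Fin (order G) → ℕ → Set where
  here : ∀ {u} → Walk D u u 0
  step : ∀ {u v w k} → Arc D u v → Walk D v w k → Walk D u w (suc k)

DistLe : {G : Graph} → Orientation G → Fin (order G) → Fin (order G) → ℕ → Set
DistLe D u v k = ∃ λ m → m ≤ k × Walk D u v m

Strong : {G : Graph} → Orientation G → Set
Strong D = ∀ u v → ∃ λ k → Walk D u v k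

DiamLe : {G : Graph} → Orientation G → ℕ → Set
DiamLe D k = ∀ u v → DistLe D u v k

Diameter : {G : Graph} → Orientation G → ℕ → Set
Diameter D k = DiamLe D k × (∀ m → DiamLe D m → k ≤ m)

OrientationNumber : Graph → ℕ → Set₁
OrientationNumber G k =
  (Σ (Orientation G) λ D → Strong D × Diameter D k)
  × (∀ (D : Orientation G) → Strong D → ∀ m → Diameter D m → k ≤ m)

{-# OPTIONS --safe #-}
-- Write X = {x₀, x₁}, A and B for the parts of sizes 2, p and q, and fix an orientation of
-- diameter 2. Every b ∈ B is "through" (x₁ → b → x₀), "reverse" (x₀ → b → x₁), a source or a
-- sink with respect to X. Two vertices of B that cannot reach each other via X do so via some
-- a ∈ A, b → a → b′, so their out-neighbourhoods in A are incomparable. If there are through but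
-- no reverse vertices, then there is at most one source or sink, and the out-neighbourhoods of
-- the through vertices together with a suitable singleton (source) or co-singleton (sink) form
-- an antichain of q subsets of A; Sperner's theorem, proved via the LYM inequality, gives
-- q ≤ C(p, ⌊p/2⌋). Symmetrically with x₀, x₁ swapped. If there are both through and reverse
-- vertices, each of the classes through, reverse, source-or-sink has at most one element; if
-- neither, there is at most one source and one sink. Either way q ≤ 3 ≤ p ≤ C(p, ⌊p/2⌋).
module Submission where

open import Algebra.Properties.CommutativeMonoid.Sum using ()
open import Data.Bool using (true; false; if_then_else_)
open import Data.Bool.Properties using (T-≡)
open import Data.Empty using (⊥; ⊥-elim)
open import Data.Fin using (Fin; zero; suc; toℕ; punchOut; _↑ˡ_; _↑ʳ_; splitAt; _≟_)
import Data.Fin.Properties as Fin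
open import Data.Fin.Properties using (toℕ-↑ˡ; toℕ-↑ʳ; toℕ<n; ↑ʳ-injective; join-splitAt; injective⇒≤; any?)
open import Data.Fin.Subset using (Subset; _∈_; _∉_; ∣_∣; ⁅_⁆; ∁; Nonempty)
open import Data.Fin.Subset.Properties using (∣p∣≤n; x∈⁅x⁆; x∈⁅y⁆⇒x≡y; x∈p⇒x∉∁p; x∉p⇒x∈∁p)
open import Data.List using (List; []; _∷_; length; map)
import Data.List as List
open import Data.List.Properties using (length-tabulate; map-cong-local)
open import Data.List.Relation.Unary.All as All using (All; []; _∷_)
open import Data.List.Relation.Unary.AllPairs using (AllPairs; []; _∷_)
open import Data.List.Relation.Unary.AllPairs.Properties using (tabulate⁺)
open import Data.Nat using (ℕ; NonZero; zero; suc; _+_; _*_; _∸_; _≤_; z≤n; s≤s; s≤s⁻¹; _<ᵇ_; _!; ⌊_/2⌋; ⌈_/2⌉)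
open import Data.Nat.Combinatorics using (_C_; nCk≡n!/k![n-k]!; k![n∸k]!∣n!)
open import Data.Nat.DivMod using (_/_; m/n*n≡m)
open import Data.Nat.Divisibility using (∣⇒≤)
open import Data.Nat.ListAction using (sum)
open import Data.Nat.Properties
  using ( +-0-commutativeMonoid; +-identityʳ; +-suc; +-assoc; +-comm; +-cancelˡ-≡; +-mono-≤
        ; *-comm; *-assoc; *-monoˡ-≤; *-cancelʳ-≤; suc-injective; ≤-refl; ≤-trans; ≤-total
        ; n≤1+n; m≤n⇒m≤1+n; m≤n⇒∃[o]m+o≡n; m+[n∸m]≡n; m+n∸m≡n; <⇒<ᵇ
        ; ⌊n/2⌋+⌈n/2⌉≡n; ⌊n/2⌋≤⌈n/2⌉; ⌊n/2⌋-mono; ⌊n/2⌋≤n; _!≢0; _!*_!≢0; module ≤-Reasoning)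
open import Data.Product using (∃; _×_; _,_; proj₁; proj₂)
open import Data.Sum using (_⊎_; inj₁; inj₂)
open import Data.Vec using ([]; _∷_; lookup; removeAt; tabulate)
open import Data.Vec.Properties using (removeAt-punchOut; []=⇒lookup; lookup⇒[]=; lookup∘tabulate)
open import Defs hiding (sym)
open import Function using (_∘_; Equivalence)
open import Relation.Binary.PropositionalEquality
open import Relation.Nullary using (¬_; Dec; yes; no; does)
open import Relation.Nullary.Decidable using (dec-true; dec-false; decidable-stable; _×-dec_)

open Algebra.Properties.CommutativeMonoid.Sum +-0-commutativeMonoid
  using (sum-syntax; ∑-distrib-+; sum-replicate-zero; sum-cong-≗)
  renaming (sum to ∑)

infix 4 _⊈_

-- Non-inclusion with an explicit witness, as needed to restrict it to a smaller ground set.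
_⊈_ : ∀ {n} → Subset n → Subset n → Set
S ⊈ T = ∃ λ i → i ∈ S × i ∉ T

Antichain : ∀ {n} → List (Subset n) → Set
Antichain = AllPairs (λ S T → S ⊈ T × T ⊈ S)

-- The number of maximal chains ∅ ⊂ … ⊂ [n] passing through a fixed k-subset.
chainsThrough : ℕ → ℕ → ℕ
chainsThrough n k = k ! * (n ∸ k) !

C*chainsThrough≡! : ∀ {n k} → k ≤ n → (n C k) * chainsThrough n k ≡ n !
C*chainsThrough≡! {n} {k} k≤n = begin
  (n C k) * chainsThrough n k                ≡⟨ cong (_* chainsThrough n k) (nCk≡n!/k![n-k]! k≤n) ⟩
  (n ! / chainsThrough n k) * chainsThrough n k ≡⟨ m/n*n≡m (k![n∸k]!∣n! k≤n) ⟩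
  n ! ∎
  where
  open ≡-Reasoning
  instance
    chainsThrough≢0 : NonZero (chainsThrough n k)
    chainsThrough≢0 = k !* (n ∸ k) !≢0

chainsThrough≤! : ∀ {n k} → k ≤ n → chainsThrough n k ≤ n !
chainsThrough≤! {n} {k} k≤n = ∣⇒≤ (k![n∸k]!∣n! k≤n)
  where
  instance
    n!≢0 : NonZero (n !)
    n!≢0 = n !≢0

!*!-shift-≤ : ∀ d a b → a + d ≤ suc b → (a + d) ! * b ! ≤ a ! * (d + b) !
!*!-shift-≤ zero    a b _ rewrite +-identityʳ a = ≤-refl
!*!-shift-≤ (suc d) a b a+1+d≤1+b rewrite +-suc a d = begin
  suc (a + d) * (a + d) ! * b ! ≤⟨ *-monoˡ-≤ (b !) (*-monoˡ-≤ ((a + d) !) a+1+d≤1+b) ⟩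
  suc b * (a + d) ! * b !       ≡⟨ cong (_* b !) (*-comm (suc b) ((a + d) !)) ⟩
  (a + d) ! * suc b * b !       ≡⟨ *-assoc ((a + d) !) (suc b) (b !) ⟩
  (a + d) ! * suc b !           ≤⟨ !*!-shift-≤ d a (suc b) (m≤n⇒m≤1+n (m≤n⇒m≤1+n (s≤s⁻¹ a+1+d≤1+b))) ⟩
  a ! * (d + suc b) !           ≡⟨ cong (λ m → a ! * m !) (+-suc d b) ⟩
  a ! * suc (d + b) !           ∎
  where open ≤-Reasoning

balanced-!*!-≤ : ∀ {a b x y} → a + b ≡ x + y → a ≤ suc b → b ≤ suc a → a ! * b ! ≤ x ! * y !
balanced-!*!-≤ {a} {b} {x} {y} a+b≡x+y a≤1+b b≤1+a with ≤-total x a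
... | inj₁ x≤a with m≤n⇒∃[o]m+o≡n x≤a
...   | d , refl with +-cancelˡ-≡ x (d + b) y (trans (sym (+-assoc x d b)) a+b≡x+y)
...     | refl = !*!-shift-≤ d x b a≤1+b
balanced-!*!-≤ {a} {b} {x} {y} a+b≡x+y a≤1+b b≤1+a | inj₂ a≤x with m≤n⇒∃[o]m+o≡n a≤x
...   | d , refl with +-cancelˡ-≡ a b (d + y) (trans a+b≡x+y (+-assoc a d y))
...     | refl = begin
  a ! * (d + y) ! ≡⟨ *-comm (a !) ((d + y) !) ⟩
  (d + y) ! * a ! ≡⟨ cong (λ m → m ! * a !) (+-comm d y) ⟩
  (y + d) ! * a ! ≤⟨ !*!-shift-≤ d y a (subst (_≤ suc a) (+-comm d y) b≤1+a) ⟩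
  y ! * (d + a) ! ≡⟨ *-comm (y !) ((d + a) !) ⟩
  (d + a) ! * y ! ≡⟨ cong (λ m → m ! * y !) (+-comm d a) ⟩
  (a + d) ! * y ! ∎
  where open ≤-Reasoning

chainsThrough-half≤ : ∀ {n k} → k ≤ n → chainsThrough n ⌊ n /2⌋ ≤ chainsThrough n k
chainsThrough-half≤ {n} {k} k≤n = subst (λ c → ⌊ n /2⌋ ! * c ! ≤ chainsThrough n k) (sym n∸⌊n/2⌋≡⌈n/2⌉)
  (balanced-!*!-≤ {x = k} {y = n ∸ k} (trans (⌊n/2⌋+⌈n/2⌉≡n n) (sym (m+[n∸m]≡n k≤n)))
                  (m≤n⇒m≤1+n (⌊n/2⌋≤⌈n/2⌉ n)) (⌊n/2⌋-mono (n≤1+n (suc n))))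
  where
  n∸⌊n/2⌋≡⌈n/2⌉ : n ∸ ⌊ n /2⌋ ≡ ⌈ n /2⌉
  n∸⌊n/2⌋≡⌈n/2⌉ = trans (cong (_∸ ⌊ n /2⌋) (sym (⌊n/2⌋+⌈n/2⌉≡n n))) (m+n∸m≡n ⌊ n /2⌋ ⌈ n /2⌉)

∑-indicator : ∀ {n} (S : Subset n) c → ∑[ i < n ] (if lookup S i then c else 0) ≡ ∣ S ∣ * c
∑-indicator []          c = refl
∑-indicator (true ∷ S)  c = cong (c +_) (∑-indicator S c)
∑-indicator (false ∷ S) c = ∑-indicator S c

∑-≤ : ∀ {n} (f : Fin n → ℕ) {c} → (∀ i → f i ≤ c) → ∑[ i < n ] f i ≤ n * c
∑-≤ {zero}  f f≤c = z≤n
∑-≤ {suc n} f f≤c = +-mono-≤ (f≤c zero) (∑-≤ (f ∘ suc) (f≤c ∘ suc))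

sum-map-∑ : ∀ {A : Set} {n} (h : A → Fin n → ℕ) (L : List A) →
            sum (map (λ x → ∑[ i < n ] h x i) L) ≡ ∑[ i < n ] sum (map (λ x → h x i) L)
sum-map-∑ {n = n} h []      = sym (sum-replicate-zero n)
sum-map-∑         h (x ∷ L) =
  trans (cong (∑ (h x) +_) (sum-map-∑ h L)) (sym (∑-distrib-+ (h x) _))

∣∣-removeAt : ∀ {n} (S : Subset (suc n)) i → lookup S i ≡ true → ∣ S ∣ ≡ suc ∣ removeAt S i ∣
∣∣-removeAt (_ ∷ _)                zero    refl = refl
∣∣-removeAt (true ∷ S@(_ ∷ _))  (suc i) S[i] = cong suc (∣∣-removeAt S i S[i])
∣∣-removeAt (false ∷ S@(_ ∷ _)) (suc i) S[i] = ∣∣-removeAt S i S[i]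

-- A maximal chain through S is determined by the element i ∈ S it adds last before reaching S
-- and a maximal chain of the remaining n-set through S ∖ {i}.
chainsThrough-split : ∀ n (S : Subset (suc n)) → Nonempty S →
  chainsThrough (suc n) ∣ S ∣ ≡ ∑[ i < suc n ] (if lookup S i then chainsThrough n ∣ removeAt S i ∣ else 0)
chainsThrough-split n S (i , i∈S) = begin
  chainsThrough (suc n) ∣ S ∣                                  ≡⟨ cong (chainsThrough (suc n)) ∣S∣≡1+k ⟩
  suc k ! * (n ∸ k) !                                          ≡⟨ *-assoc (suc k) (k !) ((n ∸ k) !) ⟩
  suc k * chainsThrough n k                                    ≡⟨ cong (_* chainsThrough n k) ∣S∣≡1+k ⟨
  ∣ S ∣ * chainsThrough n k                                    ≡⟨ ∑-indicator S (chainsThrough n k) ⟨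
  ∑[ j < suc n ] (if lookup S j then chainsThrough n k else 0) ≡⟨ sum-cong-≗ removal-size ⟩
  ∑[ j < suc n ] (if lookup S j then chainsThrough n ∣ removeAt S j ∣ else 0) ∎
  where
  open ≡-Reasoning
  k : ℕ
  k = ∣ removeAt S i ∣
  ∣S∣≡1+k : ∣ S ∣ ≡ suc k
  ∣S∣≡1+k = ∣∣-removeAt S i ([]=⇒lookup i∈S)
  removal-size : ∀ j → (if lookup S j then chainsThrough n k else 0)
                     ≡ (if lookup S j then chainsThrough n ∣ removeAt S j ∣ else 0)
  removal-size j with lookup S j in S[j]
  ... | true  = cong (chainsThrough n) (suc-injective (trans (sym ∣S∣≡1+k) (∣∣-removeAt S j S[j])))
  ... | false = refl

link : ∀ {n} → Fin (suc n) → List (Subset (suc n)) → List (Subset n)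
link i []      = []
link i (S ∷ L) = if lookup S i then removeAt S i ∷ link i L else link i L

sum-link : ∀ {n} (f : Subset n → ℕ) i (L : List (Subset (suc n))) →
  sum (map f (link i L)) ≡ sum (map (λ S → if lookup S i then f (removeAt S i) else 0) L)
sum-link f i []      = refl
sum-link f i (S ∷ L) with lookup S i
... | true  = cong (f (removeAt S i) +_) (sum-link f i L)
... | false = sum-link f i L

removeAt-⊈ : ∀ {n} {S T : Subset (suc n)} {i} → lookup S i ≡ true → lookup T i ≡ true →
             S ⊈ T → removeAt S i ⊈ removeAt T i
removeAt-⊈ {S = S} {T} {i} S[i] T[i] (j , j∈S , j∉T) =
  punchOut i≢j ,
  lookup⇒[]= _ _ (trans (removeAt-punchOut S i≢j) ([]=⇒lookup j∈S)) ,
  λ j∈T-i → j∉T (lookup⇒[]= _ _ (trans (sym (removeAt-punchOut T i≢j)) ([]=⇒lookup j∈T-i)))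
  where
  i≢j : i ≢ j
  i≢j refl = j∉T (lookup⇒[]= _ _ T[i])

link-antichain : ∀ {n} i (L : List (Subset (suc n))) → Antichain L → Antichain (link i L)
link-antichain i []      []        = []
link-antichain i (S ∷ L) (S~L ∷ ac) with lookup S i in S[i]
... | true  = link-incomparable L S~L ∷ link-antichain i L ac
  where
  link-incomparable : ∀ L → All (λ T → S ⊈ T × T ⊈ S) L →
                      All (λ T → removeAt S i ⊈ T × T ⊈ removeAt S i) (link i L)
  link-incomparable []      []                 = []
  link-incomparable (T ∷ L) ((S⊈T , T⊈S) ∷ rest) with lookup T i in T[i]
  ... | true  = (removeAt-⊈ S[i] T[i] S⊈T , removeAt-⊈ T[i] S[i] T⊈S) ∷ link-incomparable L rest
  ... | false = link-incomparable L rest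
... | false = link-antichain i L ac

antichain-nonempty : ∀ {n} {S T : Subset n} {L} → Antichain (S ∷ T ∷ L) → All Nonempty (S ∷ T ∷ L)
antichain-nonempty (((((i , i∈S , _) , (j , j∈T , _))) ∷ S~L) ∷ _) =
  (i , i∈S) ∷ (j , j∈T) ∷ All.map (λ (_ , (k , k∈U , _)) → k , k∈U) S~L

-- chainsThrough-split needs nonempty sets; all members of an antichain of size ≥ 2 are.
lym : ∀ n (L : List (Subset n)) → Antichain L → sum (map (chainsThrough n ∘ ∣_∣) L) ≤ n !
lym-nonempty : ∀ n (L : List (Subset (suc n))) → Antichain L → All Nonempty L →
               sum (map (chainsThrough (suc n) ∘ ∣_∣) L) ≤ suc n !

lym n       []          _ = z≤n
lym n       (S ∷ [])    _ = subst (_≤ n !) (sym (+-identityʳ _)) (chainsThrough≤! (∣p∣≤n S))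
lym zero    (_ ∷ _ ∷ _) ((((() , _) , _) ∷ _) ∷ _)
lym (suc n) L@(_ ∷ _ ∷ _) ac = lym-nonempty n L ac (antichain-nonempty ac)

lym-nonempty n L ac ne = begin
  sum (map (chainsThrough (suc n) ∘ ∣_∣) L)   ≡⟨ cong sum (map-cong-local (All.map (chainsThrough-split n _) ne)) ⟩
  sum (map (λ S → ∑[ i < suc n ] g S i) L)    ≡⟨ sum-map-∑ g L ⟩
  ∑[ i < suc n ] sum (map (λ S → g S i) L)    ≤⟨ ∑-≤ _ link-bound ⟩
  suc n * n !                                 ∎
  where
  open ≤-Reasoning
  g : Subset (suc n) → Fin (suc n) → ℕ
  g S i = if lookup S i then chainsThrough n ∣ removeAt S i ∣ else 0
  link-bound : ∀ i → sum (map (λ S → g S i) L) ≤ n !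
  link-bound i = subst (_≤ n !) (sum-link (chainsThrough n ∘ ∣_∣) i L)
                       (lym n (link i L) (link-antichain i L ac))

sperner : ∀ n (L : List (Subset n)) → Antichain L → length L ≤ n C ⌊ n /2⌋
sperner n L ac =
  *-cancelʳ-≤ (length L) (n C ⌊ n /2⌋) (chainsThrough n ⌊ n /2⌋) {{⌊ n /2⌋ !* (n ∸ ⌊ n /2⌋) !≢0}} (begin
  length L * chainsThrough n ⌊ n /2⌋          ≤⟨ each-at-least-half L ⟩
  sum (map (chainsThrough n ∘ ∣_∣) L)          ≤⟨ lym n L ac ⟩
  n !                                          ≡⟨ C*chainsThrough≡! (⌊n/2⌋≤n n) ⟨
  (n C ⌊ n /2⌋) * chainsThrough n ⌊ n /2⌋      ∎)
  where
  open ≤-Reasoning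
  each-at-least-half : ∀ L → length L * chainsThrough n ⌊ n /2⌋ ≤ sum (map (chainsThrough n ∘ ∣_∣) L)
  each-at-least-half []      = z≤n
  each-at-least-half (S ∷ L) = +-mono-≤ (chainsThrough-half≤ (∣p∣≤n S)) (each-at-least-half L)

sperner-family : ∀ {m n} (F : Fin m → Subset n) → (∀ {i j} → i ≢ j → F i ⊈ F j) → m ≤ n C ⌊ n /2⌋
sperner-family {m} {n} F F-⊈ =
  subst (_≤ n C ⌊ n /2⌋) (length-tabulate F)
        (sperner n (List.tabulate F) (tabulate⁺ λ i≢j → F-⊈ i≢j , F-⊈ (i≢j ∘ sym)))

n≤central-binomial : ∀ n → n ≤ n C ⌊ n /2⌋
n≤central-binomial n = sperner-family ⁅_⁆ λ {i} {j} i≢j → i , x∈⁅x⁆ i , i≢j ∘ x∈⁅y⁆⇒x≡y j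

m+n<ᵇm≡false : ∀ m n → (m + n <ᵇ m) ≡ false
m+n<ᵇm≡false zero    n = refl
m+n<ᵇm≡false (suc m) n = m+n<ᵇm≡false m n

module Layout (p q : ℕ) where

  Vertex : Set
  Vertex = Fin (2 + p + q)

  x₀ x₁ : Vertex
  x₀ = zero
  x₁ = suc zero

  A : Fin p → Vertex
  A j = suc (suc (j ↑ˡ q))

  B : Fin q → Vertex
  B t = suc (suc (p ↑ʳ t))

  partOf : Vertex → ℕ
  partOf v = part 2 p (toℕ v)

  partOf-A : ∀ j → partOf (A j) ≡ 1
  partOf-A j rewrite toℕ-↑ˡ j q | Equivalence.to T-≡ (<⇒<ᵇ (toℕ<n j)) = refl

  partOf-B : ∀ t → partOf (B t) ≡ 2
  partOf-B t rewrite toℕ-↑ʳ p t | m+n<ᵇm≡false p (toℕ t) = refl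

  B-injective : ∀ {t t'} → B t ≡ B t' → t ≡ t'
  B-injective {t} {t'} = ↑ʳ-injective p t t' ∘ Fin.suc-injective ∘ Fin.suc-injective

  -- Indexed by either ordering of {x₀, x₁}, so that every argument about X applies in both.
  data View (y₁ y₂ : Vertex) : Vertex → Set where
    at₁ : View y₁ y₂ y₁
    at₂ : View y₁ y₂ y₂
    inA : ∀ j → View y₁ y₂ (A j)
    inB : ∀ t → View y₁ y₂ (B t)

  view : ∀ v → View x₀ x₁ v
  view zero          = at₁
  view (suc zero)    = at₂
  view (suc (suc v)) with splitAt p v | join-splitAt p q v
  ... | inj₁ j | refl = inA j
  ... | inj₂ t | refl = inB t

  swap-view : ∀ {y₁ y₂ v} → View y₁ y₂ v → View y₂ y₁ v
  swap-view at₁     = at₂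
  swap-view at₂     = at₁
  swap-view (inA j) = inA j
  swap-view (inB t) = inB t

≤-by-cover : ∀ {k q} (P : Fin k → Fin q → Set) → (∀ t → ∃ λ c → P c t) →
             (∀ c {i j} → i ≢ j → P c i → P c j → ⊥) → q ≤ k
≤-by-cover P cover sparse = injective⇒≤ λ {i} {j} cᵢ≡cⱼ → decidable-stable (i ≟ j) λ i≢j →
  sparse (proj₁ (cover j)) i≢j (subst (λ c → P c i) cᵢ≡cⱼ (proj₂ (cover i))) (proj₂ (cover j))

module DiameterTwo {p q : ℕ} (D : Orientation (K3 2 p q)) (diam₂ : DiamLe D 2) where
  open Layout p q

  infix 4 _⟶_
  _⟶_ : Vertex → Vertex → Set
  u ⟶ v = Arc D u v

  ≢-parts⇒adjacent : ∀ u v {m n} → partOf u ≡ m → partOf v ≡ n → m ≢ n → Adj (K3 2 p q) u v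
  ≢-parts⇒adjacent _ _ u∈m v∈n m≢n u~v = m≢n (trans (sym u∈m) (trans u~v v∈n))

  adjacent⇒≢ : ∀ u v → Adj (K3 2 p q) u v → u ≢ v
  adjacent⇒≢ _ _ u~v refl = u~v refl

  arc? : ∀ {u v} → Adj (K3 2 p q) u v → Dec (u ⟶ v)
  arc? u~v with edge⇒arc D u~v
  ... | inj₁ u⟶v = yes u⟶v
  ... | inj₂ v⟶u = no (antisym D v⟶u)

  no-A⟶A : ∀ {j j'} → ¬ (A j ⟶ A j')
  no-A⟶A {j} {j'} a = arc⇒edge D a (trans (partOf-A j) (sym (partOf-A j')))

  no-B⟶B : ∀ {t t'} → ¬ (B t ⟶ B t')
  no-B⟶B {t} {t'} b = arc⇒edge D b (trans (partOf-B t) (sym (partOf-B t')))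

  two-step : ∀ {u v} → u ≢ v → u ⟶ v ⊎ ∃ λ w → u ⟶ w × w ⟶ v
  two-step {u} {v} u≢v with diam₂ u v
  ... | 0 , _ , here = ⊥-elim (u≢v refl)
  ... | 1 , _ , step u⟶v here = inj₁ u⟶v
  ... | 2 , _ , step u⟶w (step w⟶v here) = inj₂ (_ , u⟶w , w⟶v)
  ... | suc (suc (suc _)) , s≤s (s≤s ()) , _

  B~A : ∀ t j → Adj (K3 2 p q) (B t) (A j)
  B~A t j = ≢-parts⇒adjacent (B t) (A j) (partOf-B t) (partOf-A j) λ ()

  B⟶A? : ∀ t j → Dec (B t ⟶ A j)
  B⟶A? t j = arc? {B t} {A j} (B~A t j)

  orient : ∀ t j → B t ⟶ A j ⊎ A j ⟶ B t
  orient t j = edge⇒arc D (B~A t j)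

  out : Fin q → Subset p
  out t = tabulate λ j → does (B⟶A? t j)

  arc⇒∈out : ∀ {t j} → B t ⟶ A j → j ∈ out t
  arc⇒∈out {t} {j} b⟶a = lookup⇒[]= j (out t) (trans (lookup∘tabulate _ j) (dec-true (B⟶A? t j) b⟶a))

  arc⇒∉out : ∀ {t j} → A j ⟶ B t → j ∉ out t
  arc⇒∉out {t} {j} a⟶b j∈out
    with trans (sym ([]=⇒lookup j∈out)) (trans (lookup∘tabulate _ j) (dec-false (B⟶A? t j) (antisym D a⟶b)))
  ... | ()

  module Around (y₁ y₂ : Vertex) (y₁∈X : partOf y₁ ≡ 0) (y₂∈X : partOf y₂ ≡ 0)
                (view′ : ∀ v → View y₁ y₂ v) where

    B≢X : ∀ t y → partOf y ≡ 0 → B t ≢ y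
    B≢X t y y∈X = adjacent⇒≢ (B t) y (≢-parts⇒adjacent (B t) y (partOf-B t) y∈X λ ())

    reach-A⟶B : ∀ j t → A j ⟶ B t ⊎ (A j ⟶ y₁ × y₁ ⟶ B t) ⊎ (A j ⟶ y₂ × y₂ ⟶ B t)
    reach-A⟶B j t with two-step (adjacent⇒≢ (A j) (B t) (≢-parts⇒adjacent (A j) (B t) (partOf-A j) (partOf-B t) λ ()))
    ... | inj₁ a⟶b = inj₁ a⟶b
    ... | inj₂ (w , a⟶w , w⟶b) with view′ w
    ...   | at₁   = inj₂ (inj₁ (a⟶w , w⟶b))
    ...   | at₂   = inj₂ (inj₂ (a⟶w , w⟶b))
    ...   | inA _ = ⊥-elim (no-A⟶A a⟶w)
    ...   | inB _ = ⊥-elim (no-B⟶B w⟶b)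

    reach-B⟶A : ∀ t j → B t ⟶ A j ⊎ (B t ⟶ y₁ × y₁ ⟶ A j) ⊎ (B t ⟶ y₂ × y₂ ⟶ A j)
    reach-B⟶A t j with two-step (adjacent⇒≢ (B t) (A j) (B~A t j))
    ... | inj₁ b⟶a = inj₁ b⟶a
    ... | inj₂ (w , b⟶w , w⟶a) with view′ w
    ...   | at₁   = inj₂ (inj₁ (b⟶w , w⟶a))
    ...   | at₂   = inj₂ (inj₂ (b⟶w , w⟶a))
    ...   | inA _ = ⊥-elim (no-A⟶A w⟶a)
    ...   | inB _ = ⊥-elim (no-B⟶B b⟶w)

    reach-B⟶B : ∀ {t t'} → t ≢ t' →
      (B t ⟶ y₁ × y₁ ⟶ B t') ⊎ (B t ⟶ y₂ × y₂ ⟶ B t') ⊎ ∃ λ j → B t ⟶ A j × A j ⟶ B t'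
    reach-B⟶B t≢t' with two-step (t≢t' ∘ B-injective)
    ... | inj₁ b⟶b = ⊥-elim (no-B⟶B b⟶b)
    ... | inj₂ (w , b⟶w , w⟶b) with view′ w
    ...   | at₁   = inj₁ (b⟶w , w⟶b)
    ...   | at₂   = inj₂ (inj₁ (b⟶w , w⟶b))
    ...   | inA j = inj₂ (inj₂ (j , b⟶w , w⟶b))
    ...   | inB _ = ⊥-elim (no-B⟶B b⟶w)

    reach-B⟶X : ∀ t y → partOf y ≡ 0 → B t ⟶ y ⊎ ∃ λ j → B t ⟶ A j × A j ⟶ y
    reach-B⟶X t y y∈X with two-step (B≢X t y y∈X)
    ... | inj₁ b⟶y = inj₁ b⟶y
    ... | inj₂ (w , b⟶w , w⟶y) with view′ w
    ...   | at₁   = ⊥-elim (arc⇒edge D w⟶y (trans y₁∈X (sym y∈X)))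
    ...   | at₂   = ⊥-elim (arc⇒edge D w⟶y (trans y₂∈X (sym y∈X)))
    ...   | inA j = inj₂ (j , b⟶w , w⟶y)
    ...   | inB _ = ⊥-elim (no-B⟶B b⟶w)

    reach-X⟶B : ∀ t y → partOf y ≡ 0 → y ⟶ B t ⊎ ∃ λ j → y ⟶ A j × A j ⟶ B t
    reach-X⟶B t y y∈X with two-step (B≢X t y y∈X ∘ sym)
    ... | inj₁ y⟶b = inj₁ y⟶b
    ... | inj₂ (w , y⟶w , w⟶b) with view′ w
    ...   | at₁   = ⊥-elim (arc⇒edge D y⟶w (trans y∈X (sym y₁∈X)))
    ...   | at₂   = ⊥-elim (arc⇒edge D y⟶w (trans y∈X (sym y₂∈X)))
    ...   | inA j = inj₂ (j , y⟶w , w⟶b)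
    ...   | inB _ = ⊥-elim (no-B⟶B w⟶b)

    Through Reverse Source Sink Extreme : Fin q → Set
    Through t = B t ⟶ y₁ × y₂ ⟶ B t
    Reverse t = B t ⟶ y₂ × y₁ ⟶ B t
    Source  t = B t ⟶ y₁ × B t ⟶ y₂
    Sink    t = y₁ ⟶ B t × y₂ ⟶ B t
    Extreme t = Source t ⊎ Sink t

    data Kind (t : Fin q) : Set where
      through : Through t → Kind t
      reverse : Reverse t → Kind t
      extreme : Extreme t → Kind t

    B~X : ∀ t y → partOf y ≡ 0 → Adj (K3 2 p q) (B t) y
    B~X t y y∈X = ≢-parts⇒adjacent (B t) y (partOf-B t) y∈X λ ()

    kind : ∀ t → Kind t
    kind t with edge⇒arc D (B~X t y₁ y₁∈X) | edge⇒arc D (B~X t y₂ y₂∈X)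
    ... | inj₁ b⟶y₁ | inj₂ y₂⟶b = through (b⟶y₁ , y₂⟶b)
    ... | inj₂ y₁⟶b | inj₁ b⟶y₂ = reverse (b⟶y₂ , y₁⟶b)
    ... | inj₁ b⟶y₁ | inj₁ b⟶y₂ = extreme (inj₁ (b⟶y₁ , b⟶y₂))
    ... | inj₂ y₁⟶b | inj₂ y₂⟶b = extreme (inj₂ (y₁⟶b , y₂⟶b))

    through? : ∀ t → Dec (Through t)
    through? t = arc? {B t} {y₁} (B~X t y₁ y₁∈X) ×-dec arc? {y₂} {B t} (B~X t y₂ y₂∈X ∘ sym)

    through-out : ∀ {t j} → Through t → B t ⟶ A j → A j ⟶ y₂
    through-out {t} {j} (b⟶y₁ , _) b⟶a with reach-A⟶B j t
    ... | inj₁ a⟶b                = ⊥-elim (antisym D b⟶a a⟶b)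
    ... | inj₂ (inj₁ (_ , y₁⟶b))  = ⊥-elim (antisym D b⟶y₁ y₁⟶b)
    ... | inj₂ (inj₂ (a⟶y₂ , _)) = a⟶y₂

    through-in : ∀ {t j} → Through t → A j ⟶ B t → y₁ ⟶ A j
    through-in {t} {j} (_ , y₂⟶b) a⟶b with reach-B⟶A t j
    ... | inj₁ b⟶a                = ⊥-elim (antisym D a⟶b b⟶a)
    ... | inj₂ (inj₁ (_ , y₁⟶a))  = y₁⟶a
    ... | inj₂ (inj₂ (b⟶y₂ , _)) = ⊥-elim (antisym D y₂⟶b b⟶y₂)

    through-has-out : ∀ {t} → Through t → ∃ λ j → B t ⟶ A j
    through-has-out {t} (_ , y₂⟶b) with reach-B⟶X t y₂ y₂∈X
    ... | inj₁ b⟶y₂           = ⊥-elim (antisym D y₂⟶b b⟶y₂)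
    ... | inj₂ (j , b⟶a , _) = j , b⟶a

    through-has-in : ∀ {t} → Through t → ∃ λ j → A j ⟶ B t
    through-has-in {t} (b⟶y₁ , _) with reach-X⟶B t y₁ y₁∈X
    ... | inj₁ y₁⟶b           = ⊥-elim (antisym D b⟶y₁ y₁⟶b)
    ... | inj₂ (j , _ , a⟶b) = j , a⟶b

    source-no-out : ∀ {t j} → Source t → ¬ (B t ⟶ A j)
    source-no-out {t} {j} (b⟶y₁ , b⟶y₂) b⟶a with reach-A⟶B j t
    ... | inj₁ a⟶b               = antisym D b⟶a a⟶b
    ... | inj₂ (inj₁ (_ , y₁⟶b)) = antisym D b⟶y₁ y₁⟶b
    ... | inj₂ (inj₂ (_ , y₂⟶b)) = antisym D b⟶y₂ y₂⟶b

    sink-no-in : ∀ {t j} → Sink t → ¬ (A j ⟶ B t)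
    sink-no-in {t} {j} (y₁⟶b , y₂⟶b) a⟶b with reach-B⟶A t j
    ... | inj₁ b⟶a               = antisym D a⟶b b⟶a
    ... | inj₂ (inj₁ (b⟶y₁ , _)) = antisym D y₁⟶b b⟶y₁
    ... | inj₂ (inj₂ (b⟶y₂ , _)) = antisym D y₂⟶b b⟶y₂

    source-y₂-out : ∀ {t} → Source t → ∃ λ j → y₂ ⟶ A j
    source-y₂-out {t} (_ , b⟶y₂) with reach-X⟶B t y₂ y₂∈X
    ... | inj₁ y₂⟶b           = ⊥-elim (antisym D b⟶y₂ y₂⟶b)
    ... | inj₂ (j , y₂⟶a , _) = j , y₂⟶a

    source-X-dominates : ∀ {t} → Source t → ∀ j → y₁ ⟶ A j ⊎ y₂ ⟶ A j
    source-X-dominates {t} s j with reach-B⟶A t j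
    ... | inj₁ b⟶a               = ⊥-elim (source-no-out s b⟶a)
    ... | inj₂ (inj₁ (_ , y₁⟶a)) = inj₁ y₁⟶a
    ... | inj₂ (inj₂ (_ , y₂⟶a)) = inj₂ y₂⟶a

    sink-y₁-in : ∀ {t} → Sink t → ∃ λ j → A j ⟶ y₁
    sink-y₁-in {t} (y₁⟶b , _) with reach-B⟶X t y₁ y₁∈X
    ... | inj₁ b⟶y₁           = ⊥-elim (antisym D y₁⟶b b⟶y₁)
    ... | inj₂ (j , _ , a⟶y₁) = j , a⟶y₁

    two-sources : ∀ {i j} → i ≢ j → Source i → Source j → ⊥
    two-sources i≢j sᵢ (bⱼ⟶y₁ , bⱼ⟶y₂) with reach-B⟶B i≢j
    ... | inj₁ (_ , y₁⟶bⱼ)          = antisym D bⱼ⟶y₁ y₁⟶bⱼ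
    ... | inj₂ (inj₁ (_ , y₂⟶bⱼ))   = antisym D bⱼ⟶y₂ y₂⟶bⱼ
    ... | inj₂ (inj₂ (_ , bᵢ⟶a , _)) = source-no-out sᵢ bᵢ⟶a

    two-sinks : ∀ {i j} → i ≢ j → Sink i → Sink j → ⊥
    two-sinks i≢j (y₁⟶bᵢ , y₂⟶bᵢ) kⱼ with reach-B⟶B i≢j
    ... | inj₁ (bᵢ⟶y₁ , _)          = antisym D y₁⟶bᵢ bᵢ⟶y₁
    ... | inj₂ (inj₁ (bᵢ⟶y₂ , _))   = antisym D y₂⟶bᵢ bᵢ⟶y₂
    ... | inj₂ (inj₂ (_ , _ , a⟶bⱼ)) = sink-no-in kⱼ a⟶bⱼ

    -- The sink yields a ⟶ y₁, the source then forces y₂ ⟶ a, and neither orientation of the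
    -- edge between the through vertex and a is compatible with both.
    through-source-sink : ∀ {t s k} → Through t → Source s → Sink k → ⊥
    through-source-sink {t} th src snk with sink-y₁-in snk
    ... | a , a⟶y₁ with source-X-dominates src a
    ...   | inj₁ y₁⟶a = antisym D a⟶y₁ y₁⟶a
    ...   | inj₂ y₂⟶a with orient t a
    ...     | inj₁ b⟶a = antisym D y₂⟶a (through-out th b⟶a)
    ...     | inj₂ a⟶b = antisym D a⟶y₁ (through-in th a⟶b)

    two-extremes : ∀ {t i j} → Through t → i ≢ j → Extreme i → Extreme j → ⊥
    two-extremes th i≢j (inj₁ sᵢ) (inj₁ sⱼ) = two-sources i≢j sᵢ sⱼ
    two-extremes th i≢j (inj₂ kᵢ) (inj₂ kⱼ) = two-sinks i≢j kᵢ kⱼ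
    two-extremes th i≢j (inj₁ sᵢ) (inj₂ kⱼ) = through-source-sink th sᵢ kⱼ
    two-extremes th i≢j (inj₂ kᵢ) (inj₁ sⱼ) = through-source-sink th sⱼ kᵢ

    through⊈through : ∀ {i j} → i ≢ j → Through i → Through j → out i ⊈ out j
    through⊈through i≢j (_ , y₂⟶bᵢ) (bⱼ⟶y₁ , _) with reach-B⟶B i≢j
    ... | inj₁ (_ , y₁⟶bⱼ)             = ⊥-elim (antisym D bⱼ⟶y₁ y₁⟶bⱼ)
    ... | inj₂ (inj₁ (bᵢ⟶y₂ , _))      = ⊥-elim (antisym D y₂⟶bᵢ bᵢ⟶y₂)
    ... | inj₂ (inj₂ (a , bᵢ⟶a , a⟶bⱼ)) = a , arc⇒∈out bᵢ⟶a , arc⇒∉out a⟶bⱼ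

    -- The set standing in for out t when b_t is a source (out t = ∅) or a sink (out t = A).
    extremeSet : ∀ {t} → Extreme t → Subset p
    extremeSet (inj₁ src) = ⁅ proj₁ (source-y₂-out src) ⁆
    extremeSet (inj₂ snk) = ∁ ⁅ proj₁ (sink-y₁-in snk) ⁆

    out⊈extremeSet : ∀ {t t'} → Through t → (e : Extreme t') → out t ⊈ extremeSet e
    out⊈extremeSet th (inj₁ src) with source-y₂-out src | through-has-out th
    ... | a , y₂⟶a | j , b⟶aⱼ = j , arc⇒∈out b⟶aⱼ , j∉⁅a⁆
      where
      j∉⁅a⁆ : j ∉ ⁅ a ⁆
      j∉⁅a⁆ j∈⁅a⁆ with x∈⁅y⁆⇒x≡y a j∈⁅a⁆
      ... | refl = antisym D y₂⟶a (through-out th b⟶aⱼ)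
    out⊈extremeSet {t} th (inj₂ snk) with sink-y₁-in snk
    ... | a , a⟶y₁ = a , a∈out , x∈p⇒x∉∁p (x∈⁅x⁆ a)
      where
      a∈out : a ∈ out t
      a∈out with orient t a
      ... | inj₁ b⟶a = arc⇒∈out b⟶a
      ... | inj₂ a⟶b = ⊥-elim (antisym D a⟶y₁ (through-in th a⟶b))

    extremeSet⊈out : ∀ {t t'} → (e : Extreme t) → Through t' → extremeSet e ⊈ out t'
    extremeSet⊈out {t' = t'} (inj₁ src) th with source-y₂-out src
    ... | a , y₂⟶a = a , x∈⁅x⁆ a , a∉out
      where
      a∉out : a ∉ out t'
      a∉out with orient t' a
      ... | inj₁ b⟶a = ⊥-elim (antisym D y₂⟶a (through-out th b⟶a))
      ... | inj₂ a⟶b = arc⇒∉out a⟶b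
    extremeSet⊈out (inj₂ snk) th with sink-y₁-in snk | through-has-in th
    ... | a , a⟶y₁ | j , aⱼ⟶b = j , x∉p⇒x∈∁p j∉⁅a⁆ , arc⇒∉out aⱼ⟶b
      where
      j∉⁅a⁆ : j ∉ ⁅ a ⁆
      j∉⁅a⁆ j∈⁅a⁆ with x∈⁅y⁆⇒x≡y a j∈⁅a⁆
      ... | refl = antisym D a⟶y₁ (through-in th aⱼ⟶b)

    module WithoutReverse {t₀} (th₀ : Through t₀) (no-reverse : ∀ t → ¬ Reverse t) where

      member : ∀ {t} → Kind t → Subset p
      member {t} (through _) = out t
      member     (reverse r) = ⊥-elim (no-reverse _ r)
      member     (extreme e) = extremeSet e

      members-⊈ : ∀ {i j} → i ≢ j → (kᵢ : Kind i) (kⱼ : Kind j) → member kᵢ ⊈ member kⱼ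
      members-⊈ i≢j (through thᵢ) (through thⱼ) = through⊈through i≢j thᵢ thⱼ
      members-⊈ i≢j (through thᵢ) (extreme eⱼ)  = out⊈extremeSet thᵢ eⱼ
      members-⊈ i≢j (extreme eᵢ)  (through thⱼ) = extremeSet⊈out eᵢ thⱼ
      members-⊈ i≢j (extreme eᵢ)  (extreme eⱼ)  = ⊥-elim (two-extremes th₀ i≢j eᵢ eⱼ)
      members-⊈ i≢j (reverse r)   _             = ⊥-elim (no-reverse _ r)
      members-⊈ i≢j (through _)   (reverse r)   = ⊥-elim (no-reverse _ r)
      members-⊈ i≢j (extreme _)   (reverse r)   = ⊥-elim (no-reverse _ r)

      q≤central-binomial : q ≤ p C ⌊ p /2⌋
      q≤central-binomial = sperner-family (member ∘ kind) (λ i≢j → members-⊈ i≢j (kind _) (kind _))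

    no-through-or-reverse⇒q≤2 : (∀ t → ¬ Through t) → (∀ t → ¬ Reverse t) → q ≤ 2
    no-through-or-reverse⇒q≤2 ∄through ∄reverse = ≤-by-cover classes cover sparse
      where
      classes : Fin 2 → Fin q → Set
      classes zero       = Source
      classes (suc zero) = Sink
      cover : ∀ t → ∃ λ c → classes c t
      cover t with kind t
      ... | through th         = ⊥-elim (∄through t th)
      ... | reverse r          = ⊥-elim (∄reverse t r)
      ... | extreme (inj₁ src) = zero , src
      ... | extreme (inj₂ snk) = suc zero , snk
      sparse : ∀ c {i j} → i ≢ j → classes c i → classes c j → ⊥
      sparse zero       = two-sources
      sparse (suc zero) = two-sinks

  module BothWays (y₁ y₂ : Vertex) (y₁∈X : partOf y₁ ≡ 0) (y₂∈X : partOf y₂ ≡ 0)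
                  (view′ : ∀ v → View y₁ y₂ v) where
    open Around y₁ y₂ y₁∈X y₂∈X view′
    private module Op = Around y₂ y₁ y₂∈X y₁∈X (swap-view ∘ view′)

    -- Through vertices and reverse vertices have the same out-neighbourhood in A,
    -- so no a ∈ A separates two through vertices.
    two-throughs : ∀ {t₀ i j} → Reverse t₀ → i ≢ j → Through i → Through j → ⊥
    two-throughs {t₀} r i≢j thᵢ@(_ , y₂⟶bᵢ) thⱼ@(bⱼ⟶y₁ , _) with reach-B⟶B i≢j
    ... | inj₁ (_ , y₁⟶bⱼ)             = antisym D bⱼ⟶y₁ y₁⟶bⱼ
    ... | inj₂ (inj₁ (bᵢ⟶y₂ , _))      = antisym D y₂⟶bᵢ bᵢ⟶y₂
    ... | inj₂ (inj₂ (a , bᵢ⟶a , a⟶bⱼ)) with orient t₀ a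
    ...   | inj₁ b₀⟶a = antisym D (Op.through-out r b₀⟶a) (through-in thⱼ a⟶bⱼ)
    ...   | inj₂ a⟶b₀ = antisym D (through-out thᵢ bᵢ⟶a) (Op.through-in r a⟶b₀)

  private
    module P = Around x₀ x₁ refl refl view
    module Q = Around x₁ x₀ refl refl (swap-view ∘ view)

  through-and-reverse⇒q≤3 : ∀ {t₁ t₂} → P.Through t₁ → P.Reverse t₂ → q ≤ 3
  through-and-reverse⇒q≤3 th r = ≤-by-cover classes cover sparse
    where
    classes : Fin 3 → Fin q → Set
    classes zero             = P.Through
    classes (suc zero)       = P.Reverse
    classes (suc (suc zero)) = P.Extreme
    cover : ∀ t → ∃ λ c → classes c t
    cover t with P.kind t
    ... | P.through th′ = zero , th′
    ... | P.reverse r′  = suc zero , r′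
    ... | P.extreme e   = suc (suc zero) , e
    sparse : ∀ c {i j} → i ≢ j → classes c i → classes c j → ⊥
    sparse zero             = BothWays.two-throughs x₀ x₁ refl refl view r
    sparse (suc zero)       = BothWays.two-throughs x₁ x₀ refl refl (swap-view ∘ view) th
    sparse (suc (suc zero)) = P.two-extremes th

  q≤central-binomial : 3 ≤ p → q ≤ p C ⌊ p /2⌋
  q≤central-binomial 3≤p with any? P.through? | any? Q.through?
  ... | yes (_ , th) | yes (_ , r) = ≤-trans (through-and-reverse⇒q≤3 th r) (≤-trans 3≤p (n≤central-binomial p))
  ... | yes (_ , th) | no ∄r       = P.WithoutReverse.q≤central-binomial th λ t r → ∄r (t , r)
  ... | no ∄th       | yes (_ , r) = Q.WithoutReverse.q≤central-binomial r λ t th → ∄th (t , th)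
  ... | no ∄th       | no ∄r       =
    ≤-trans (P.no-through-or-reverse⇒q≤2 (λ t th → ∄th (t , th)) (λ t r → ∄r (t , r)))
            (≤-trans (n≤1+n 2) (≤-trans 3≤p (n≤central-binomial p)))

theorem2p3 : ∀ (p q : ℕ) → 3 ≤ p → p ≤ q →
    OrientationNumber (K3 2 p q) 2 → q ≤ p C ⌊ p /2⌋
theorem2p3 p q 3≤p _ ((D , _ , diam≤2 , _) , _) = DiameterTwo.q≤central-binomial D diam≤2 3≤p
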